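{- Let $\mathcal{M}=(Q,r)$ be a matroid and let $X,Y\subseteq Q$ be a nonmodular pair of flats of $\mathcal{M}$ with $r(X)=2$. Then $\mathcal{M}$ admits an AK extension for $(X,Y)$.
   Context: Write $AB=A\cup B$ and $r(A|B)=r(AB)-r(B)$. A flat is a set $F$ with $r(Fx)>r(F)$ for all $x\notin F$; flats $X,Y$ are modular if $r(X)+r(Y)=r(XY)+r(X\cap Y)$, nonmodular otherwise. An extension of $(Q,r)$ is a polymatroid $(QZ,g)$ with $Q\cap Z=\emptyset$ and $g=r$ on subsets of $Q$. An AK extension for $(X,Y)$ is an extension $(QZ,g)$ with (AK1) $g(Z|X)=0$ and (AK2) $g(X'|Z)=g(X'|Y)$ for every $X'\subseteq X$. -}

module Defs where

open import Data.Nat using (ℕ; _+_; _<_; _≤_)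
open import Data.Fin using (Fin)
open import Data.Fin.Subset using (Subset; _∪_; _∩_; _⊆_; _∉_; ⁅_⁆; ⊥; ⊤; ∣_∣)
open import Data.Vec using (_++_)
open import Data.Integer using (+_)
import Data.Rational as ℚ
open ℚ using (ℚ)
open import Data.Product using (Σ; _×_)
open import Relation.Binary.PropositionalEquality using (_≡_; _≢_)

record IsMatroid (n : ℕ) (r : Subset n → ℕ) : Set where
  field
    bounded    : ∀ A → r A ≤ ∣ A ∣
    monotone   : ∀ A B → A ⊆ B → r A ≤ r B
    submodular : ∀ A B → r (A ∪ B) + r (A ∩ B) ≤ r A + r B

record IsPolymatroid (N : ℕ) (g : Subset N → ℚ) : Set where
  field
    normalized : g ⊥ ≡ ℚ.0ℚ
    monotone   : ∀ A B → A ⊆ B → g A ℚ.≤ g B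
    submodular : ∀ A B → (g (A ∪ B) ℚ.+ g (A ∩ B)) ℚ.≤ (g A ℚ.+ g B)

IsFlat : {n : ℕ} → (Subset n → ℕ) → Subset n → Set
IsFlat {n} r F = ∀ (x : Fin n) → x ∉ F → r F < r (F ∪ ⁅ x ⁆)

Nonmodular : {n : ℕ} → (Subset n → ℕ) → Subset n → Subset n → Set
Nonmodular r X Y = r X + r Y ≢ r (X ∪ Y) + r (X ∩ Y)

toℚ : ℕ → ℚ
toℚ k = (+ k) ℚ./ 1

-- Extension ground set QZ = Fin (n + m): Q = first n elements, Z = last m.
embQ : {n : ℕ} (m : ℕ) → Subset n → Subset (n + m)
embQ m S = S ++ ⊥

Zset : (n m : ℕ) → Subset (n + m)
Zset n m = ⊥ {n} ++ ⊤ {m}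

cond : {N : ℕ} → (Subset N → ℚ) → Subset N → Subset N → ℚ
cond g A B = g (A ∪ B) ℚ.- g B

IsExtension : (n m : ℕ) → (Subset n → ℕ) → (Subset (n + m) → ℚ) → Set
IsExtension n m r g =
  IsPolymatroid (n + m) g × (∀ (S : Subset n) → g (embQ m S) ≡ toℚ (r S))

IsAKExtension : (n m : ℕ) → (Subset n → ℕ) → (Subset (n + m) → ℚ) →
                Subset n → Subset n → Set
IsAKExtension n m r g X Y =
  IsExtension n m r g
  × (cond g (Zset n m) (embQ m X) ≡ ℚ.0ℚ)
  × (∀ (X' : Subset n) → X' ⊆ X →
       cond g (embQ m X') (Zset n m) ≡ cond g (embQ m X') (embQ m Y))

AdmitsAKExtension : (n : ℕ) → (Subset n → ℕ) → Subset n → Subset n → Set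
AdmitsAKExtension n r X Y =
  Σ ℕ (λ m → Σ (Subset (n + m) → ℚ) (λ g → IsAKExtension n m r g X Y))

{-# OPTIONS --safe #-}
-- Add a single point z placed freely on the line X, i.e. take the principal extension of the
-- matroid by the modular cut of flats containing X: r(A ∪ z) = min (r A + 1, r (A ∪ X)).
-- Its rank function is submodular because the sets spanning X form a modular cut, and z lies
-- in the closure of X, which is (AK1). As Y is a flat and (X, Y) is nonmodular with r X = 2,
-- X meets Y only in loops and r (X ∪ Y) = r Y + 1. So conditioning on z and conditioning on Y
-- both give rank 0 to the loops in X and rank 1 to every other subset of X, which is (AK2).
module Submission where

open import Defs
open import Data.Bool using (Bool; true; false; _∨_; _∧_)
open import Data.Fin.Subset using (Subset; _∪_; _∩_; _⊆_; _∈_; ⊥; ⁅_⁆)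
open import Data.Fin.Subset.Properties
  using (p⊆p∪q; q⊆p∪q; x∈p∪q⁻; x∈p∩q⁺; x∈⁅y⁆⇒x≡y; _∈?_; ∣⊥∣≡0; ⊥⊆; ⊆-refl; ⊆-antisym;
         ∪-comm; ∩-comm; ∪-idem; ∪-identityˡ; ∪-identityʳ; ∪-distribʳ-∩)
open import Data.Nat using (ℕ; zero; suc; _+_; _≤_; _<_; _⊓_; _≟_; _≤?_; s≤s; s≤s⁻¹)
open import Data.Nat.Properties
open import Data.Nat.Divisibility using (∣1⇒≡1)
import Data.Integer as ℤ
import Data.Integer.Properties as ℤ using (*-identityʳ)
open import Data.Rational as ℚ using (mkℚ; 0ℚ)
import Data.Rational.Properties as ℚ
open import Data.Rational.Solver using (module +-*-Solver)
open import Data.Product using (_×_; _,_; proj₁; proj₂; ∃₂)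
open import Data.Sum using (inj₁; inj₂)
open import Data.Vec using (_∷_; []; _++_; take; drop; head; zipWith)
open import Data.Vec.Properties using (take++drop≡id; ++-injectiveˡ; ++-injectiveʳ; zipWith-++)
open import Function using (_∘_; id)
open import Relation.Nullary using (¬_; Dec; yes; no; contradiction)
open import Relation.Binary.PropositionalEquality

∪-least : ∀ {N} {A B C : Subset N} → A ⊆ C → B ⊆ C → A ∪ B ⊆ C
∪-least {A = A} {B} A⊆C B⊆C x∈A∪B with x∈p∪q⁻ A B x∈A∪B
... | inj₁ x∈A = A⊆C x∈A
... | inj₂ x∈B = B⊆C x∈B

∩-greatest : ∀ {N} {A B C : Subset N} → A ⊆ B → A ⊆ C → A ⊆ B ∩ C
∩-greatest A⊆B A⊆C x∈A = x∈p∩q⁺ (A⊆B x∈A , A⊆C x∈A)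

∪-mono-⊆ : ∀ {N} {A A′ B B′ : Subset N} → A ⊆ A′ → B ⊆ B′ → A ∪ B ⊆ A′ ∪ B′
∪-mono-⊆ {A′ = A′} {B′ = B′} A⊆A′ B⊆B′ = ∪-least (p⊆p∪q B′ ∘ A⊆A′) (q⊆p∪q A′ B′ ∘ B⊆B′)

p⊆q⇒p∪q≡q : ∀ {N} {S T : Subset N} → S ⊆ T → S ∪ T ≡ T
p⊆q⇒p∪q≡q {S = S} {T} S⊆T = ⊆-antisym (∪-least S⊆T id) (q⊆p∪q S T)

split : ∀ {n} (S : Subset (n + 1)) → ∃₂ λ A b → S ≡ A ++ b ∷ []
split {n} S with take n S | drop n S | take++drop≡id n S
... | A | b ∷ [] | A++b≡S = A , b , sym A++b≡S

⊥-++ : ∀ m {k} → ⊥ {m + k} ≡ ⊥ {m} ++ ⊥ {k}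
⊥-++ zero    = refl
⊥-++ (suc m) = cong (false ∷_) (⊥-++ m)

toℚ≡mkℚ : ∀ k → toℚ k ≡ mkℚ (ℤ.+ k) 0 (λ d∣k×d∣1 → ∣1⇒≡1 (proj₂ d∣k×d∣1))
toℚ≡mkℚ k = ℚ.normalize-coprime _

toℚ-+ : ∀ a b → toℚ (a + b) ≡ toℚ a ℚ.+ toℚ b
toℚ-+ a b rewrite toℚ≡mkℚ a | toℚ≡mkℚ b =
  ℚ./-cong (cong₂ ℤ._+_ (sym (ℤ.*-identityʳ (ℤ.+ a))) (sym (ℤ.*-identityʳ (ℤ.+ b)))) refl

toℚ-mono-≤ : ∀ {a b} → a ≤ b → toℚ a ℚ.≤ toℚ b
toℚ-mono-≤ {a} {b} a≤b rewrite toℚ≡mkℚ a | toℚ≡mkℚ b =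
  ℚ.*≤* (subst₂ ℤ._≤_ (sym (ℤ.*-identityʳ (ℤ.+ a))) (sym (ℤ.*-identityʳ (ℤ.+ b))) (ℤ.+≤+ a≤b))

toℚ-cancel : ∀ a b c d → a + d ≡ c + b → toℚ a ℚ.- toℚ b ≡ toℚ c ℚ.- toℚ d
toℚ-cancel a b c d a+d≡c+b = begin
  p ℚ.- q                  ≡⟨ solve 3 (λ p q s → p :- q := (p :+ s) :- (s :+ q)) refl p q s ⟩
  (p ℚ.+ s) ℚ.- (s ℚ.+ q)  ≡⟨ cong (ℚ._- (s ℚ.+ q)) p+s≡c+q ⟩
  (c′ ℚ.+ q) ℚ.- (s ℚ.+ q) ≡⟨ solve 3 (λ c q s → (c :+ q) :- (s :+ q) := c :- s) refl c′ q s ⟩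
  c′ ℚ.- s                 ∎
  where
  open ≡-Reasoning
  open +-*-Solver
  p = toℚ a; q = toℚ b; c′ = toℚ c; s = toℚ d
  p+s≡c+q : p ℚ.+ s ≡ c′ ℚ.+ q
  p+s≡c+q = trans (sym (toℚ-+ a d)) (trans (cong toℚ a+d≡c+b) (toℚ-+ c b))

isPolymatroid-toℚ : ∀ {N} (G : Subset N → ℕ) → G ⊥ ≡ 0 →
                    (∀ S T → G S ≤ G (S ∪ T)) →
                    (∀ S T → G (S ∪ T) + G (S ∩ T) ≤ G S + G T) →
                    IsPolymatroid N (toℚ ∘ G)
isPolymatroid-toℚ G G⊥≡0 G-mono G-submodular = record
  { normalized = cong toℚ G⊥≡0
  ; monotone   = λ S T S⊆T →
      toℚ-mono-≤ (subst (λ U → G S ≤ G U) (p⊆q⇒p∪q≡q S⊆T) (G-mono S T))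
  ; submodular = λ S T →
      subst₂ ℚ._≤_ (toℚ-+ (G (S ∪ T)) (G (S ∩ T))) (toℚ-+ (G S) (G T))
                   (toℚ-mono-≤ (G-submodular S T))
  }

cond-toℚ-≡ : ∀ {N} (G : Subset N → ℕ) {A B C D} → G (A ∪ B) + G D ≡ G (C ∪ D) + G B →
             cond (toℚ ∘ G) A B ≡ cond (toℚ ∘ G) C D
cond-toℚ-≡ G {A} {B} {C} {D} = toℚ-cancel (G (A ∪ B)) (G B) (G (C ∪ D)) (G D)

cond-toℚ-≡0 : ∀ {N} (G : Subset N → ℕ) {A B} → G (A ∪ B) ≡ G B → cond (toℚ ∘ G) A B ≡ 0ℚ
cond-toℚ-≡0 G {A} {B} eq =
  trans (cong (λ k → toℚ k ℚ.- toℚ (G B)) eq) (ℚ.+-inverseʳ (toℚ (G B)))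

-- P A b is the value on A ∪ {z} if b holds and on A otherwise, z being the new last element.
module OneElementExtension {n : ℕ} (P : Subset n → Bool → ℕ) where

  extend : Subset (n + 1) → ℕ
  extend S = P (take n S) (head (drop n S))

  extend-++ : ∀ A b → extend (A ++ b ∷ []) ≡ P A b
  extend-++ A b = cong₂ P (++-injectiveˡ (take n S) A S≡) (cong head (++-injectiveʳ (take n S) A S≡))
    where
    S = A ++ b ∷ []
    S≡ : take n S ++ drop n S ≡ A ++ b ∷ []
    S≡ = take++drop≡id n S

  extend-zipWith : ∀ (f : Bool → Bool → Bool) A a B b →
                   extend (zipWith f (A ++ a ∷ []) (B ++ b ∷ [])) ≡ P (zipWith f A B) (f a b)
  extend-zipWith f A a B b =
    trans (cong extend (zipWith-++ f A (a ∷ []) B (b ∷ []))) (extend-++ (zipWith f A B) (f a b))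

  extend-monotone : (∀ A a B b → P A a ≤ P (A ∪ B) (a ∨ b)) → ∀ S T → extend S ≤ extend (S ∪ T)
  extend-monotone P-mono S T with split S | split T
  ... | A , a , refl | B , b , refl =
    subst₂ _≤_ (sym (extend-++ A a)) (sym (extend-zipWith _∨_ A a B b)) (P-mono A a B b)

  extend-submodular : (∀ A a B b → P (A ∪ B) (a ∨ b) + P (A ∩ B) (a ∧ b) ≤ P A a + P B b) →
                      ∀ S T → extend (S ∪ T) + extend (S ∩ T) ≤ extend S + extend T
  extend-submodular P-submodular S T with split S | split T
  ... | A , a , refl | B , b , refl =
    subst₂ _≤_ (sym (cong₂ _+_ (extend-zipWith _∨_ A a B b) (extend-zipWith _∧_ A a B b)))
               (sym (cong₂ _+_ (extend-++ A a) (extend-++ B b)))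
               (P-submodular A a B b)

module Matroid {n : ℕ} {r : Subset n → ℕ} (isMatroid : IsMatroid n r) where
  open IsMatroid isMatroid

  r-mono : ∀ {A B} → A ⊆ B → r A ≤ r B
  r-mono = monotone _ _

  r⊥≡0 : r ⊥ ≡ 0
  r⊥≡0 = n≤0⇒n≡0 (≤-trans (bounded ⊥) (≤-reflexive (∣⊥∣≡0 n)))

  rank-∪-null : ∀ {A} B → r A ≡ 0 → r (A ∪ B) ≡ r B
  rank-∪-null {A} B rA≡0 = ≤-antisym
    (begin
      r (A ∪ B)             ≤⟨ m≤m+n (r (A ∪ B)) (r (A ∩ B)) ⟩
      r (A ∪ B) + r (A ∩ B) ≤⟨ submodular A B ⟩
      r A + r B             ≡⟨ cong (_+ r B) rA≡0 ⟩
      r B                   ∎)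
    (r-mono (q⊆p∪q A B))
    where open ≤-Reasoning

  flat-closed : ∀ {Y T} → IsFlat r Y → r (T ∪ Y) ≤ r Y → T ⊆ Y
  flat-closed {Y} {T} Y-flat rT∪Y≤rY {x} x∈T with x ∈? Y
  ... | yes x∈Y = x∈Y
  ... | no  x∉Y = contradiction (≤-trans (r-mono Y∪x⊆T∪Y) rT∪Y≤rY) (<⇒≱ (Y-flat x x∉Y))
    where
    Y∪x⊆T∪Y : Y ∪ ⁅ x ⁆ ⊆ T ∪ Y
    Y∪x⊆T∪Y = ∪-least (q⊆p∪q T Y)
                      (λ y∈⁅x⁆ → p⊆p∪q Y (subst (_∈ T) (sym (x∈⁅y⁆⇒x≡y x y∈⁅x⁆)) x∈T))

  nonmodular⇒r[Y]<r[X∪Y] : ∀ {X Y} → IsFlat r Y → Nonmodular r X Y → r Y < r (X ∪ Y)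
  nonmodular⇒r[Y]<r[X∪Y] {X} {Y} Y-flat nonmodular with r (X ∪ Y) ≤? r Y
  ... | no  rX∪Y≰rY = ≰⇒> rX∪Y≰rY
  ... | yes rX∪Y≤rY = contradiction (≤-antisym modular≥ (submodular X Y)) nonmodular
    where
    modular≥ : r X + r Y ≤ r (X ∪ Y) + r (X ∩ Y)
    modular≥ = begin
      r X + r Y             ≤⟨ +-mono-≤ (r-mono (∩-greatest ⊆-refl (flat-closed Y-flat rX∪Y≤rY)))
                                        (r-mono (q⊆p∪q X Y)) ⟩
      r (X ∩ Y) + r (X ∪ Y) ≡⟨ +-comm (r (X ∩ Y)) (r (X ∪ Y)) ⟩
      r (X ∪ Y) + r (X ∩ Y) ∎
      where open ≤-Reasoning

  nonmodular-rank≤2 : ∀ {X Y} → IsFlat r Y → Nonmodular r X Y → r X ≤ 2 →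
                      r (X ∩ Y) ≡ 0 × r (X ∪ Y) ≡ suc (r Y)
  nonmodular-rank≤2 {X} {Y} Y-flat nonmodular rX≤2 =
    n≤0⇒n≡0 rX∩Y≤0 , ≤-antisym (≤-trans (m≤m+n _ _) sum≤) rY<rX∪Y
    where
    rY<rX∪Y = nonmodular⇒r[Y]<r[X∪Y] Y-flat nonmodular
    sum≤ : r (X ∪ Y) + r (X ∩ Y) ≤ suc (r Y)
    sum≤ = s≤s⁻¹ (≤-trans (≤∧≢⇒< (submodular X Y) (nonmodular ∘ sym)) (+-monoˡ-≤ (r Y) rX≤2))
    rX∩Y≤0 : r (X ∩ Y) ≤ 0
    rX∩Y≤0 = +-cancelˡ-≤ (suc (r Y)) _ _ (begin
      suc (r Y) + r (X ∩ Y) ≤⟨ +-monoˡ-≤ (r (X ∩ Y)) rY<rX∪Y ⟩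
      r (X ∪ Y) + r (X ∩ Y) ≤⟨ sum≤ ⟩
      suc (r Y)             ≡⟨ sym (+-identityʳ (suc (r Y))) ⟩
      suc (r Y) + 0         ∎)
      where open ≤-Reasoning

  rank-∪-nonnull : ∀ {X Y A} → IsFlat r Y → r (X ∩ Y) ≡ 0 → r (X ∪ Y) ≡ suc (r Y) →
                   A ⊆ X → r A ≢ 0 → r (A ∪ Y) ≡ suc (r Y)
  rank-∪-nonnull {X} {Y} {A} Y-flat rX∩Y≡0 rX∪Y≡1+rY A⊆X rA≢0 with r (A ∪ Y) ≤? r Y
  ... | no  rA∪Y≰rY =
    ≤-antisym (≤-trans (r-mono (∪-mono-⊆ A⊆X ⊆-refl)) (≤-reflexive rX∪Y≡1+rY)) (≰⇒> rA∪Y≰rY)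
  ... | yes rA∪Y≤rY = contradiction (n≤0⇒n≡0 (≤-trans (r-mono A⊆X∩Y) (≤-reflexive rX∩Y≡0))) rA≢0
    where
    A⊆X∩Y : A ⊆ X ∩ Y
    A⊆X∩Y = ∩-greatest A⊆X (flat-closed Y-flat rA∪Y≤rY)

module PrincipalExtension {n : ℕ} {r : Subset n → ℕ} (isMatroid : IsMatroid n r)
                          (X : Subset n) where
  open IsMatroid isMatroid
  open Matroid isMatroid using (r-mono)

  Spans : Subset n → Set
  Spans A = r (A ∪ X) ≤ r A

  spans? : ∀ A → Dec (Spans A)
  spans? A = r (A ∪ X) ≤? r A

  spans-⊆ : ∀ {A B} → A ⊆ B → Spans A → Spans B
  spans-⊆ {A} {B} A⊆B A-spans = +-cancelʳ-≤ (r A) (r (B ∪ X)) (r B) (begin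
    r (B ∪ X) + r A                   ≤⟨ +-mono-≤ (r-mono (∪-mono-⊆ ⊆-refl (q⊆p∪q A X)))
                                                  (r-mono (∩-greatest A⊆B (p⊆p∪q X))) ⟩
    r (B ∪ (A ∪ X)) + r (B ∩ (A ∪ X)) ≤⟨ submodular B (A ∪ X) ⟩
    r B + r (A ∪ X)                   ≤⟨ +-monoʳ-≤ (r B) A-spans ⟩
    r B + r A                         ∎)
    where open ≤-Reasoning

  spans-modular : ∀ {A B} → Spans A → Spans B → r (A ∪ B) + r ((A ∩ B) ∪ X) ≤ r A + r B
  spans-modular {A} {B} A-spans B-spans = begin
    r (A ∪ B) + r ((A ∩ B) ∪ X)                   ≤⟨ +-mono-≤ A∪B≤ (≤-reflexive A∩B∪X≡) ⟩
    r ((A ∪ X) ∪ (B ∪ X)) + r ((A ∪ X) ∩ (B ∪ X)) ≤⟨ submodular (A ∪ X) (B ∪ X) ⟩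
    r (A ∪ X) + r (B ∪ X)                         ≤⟨ +-mono-≤ A-spans B-spans ⟩
    r A + r B                                     ∎
    where
    open ≤-Reasoning
    A∪B≤ = r-mono (∪-mono-⊆ (p⊆p∪q X) (p⊆p∪q X))
    A∩B∪X≡ = cong r (∪-distribʳ-∩ X A B)

  -- The rank of A ∪ {z} for the new point z.
  r⁺ : Subset n → ℕ
  r⁺ A = suc (r A) ⊓ r (A ∪ X)

  r⁺-spans : ∀ {A} → Spans A → r⁺ A ≡ r A
  r⁺-spans {A} A-spans =
    trans (m≥n⇒m⊓n≡n (m≤n⇒m≤1+n A-spans)) (≤-antisym A-spans (r-mono (p⊆p∪q X)))

  r⁺-¬spans : ∀ {A} → ¬ Spans A → r⁺ A ≡ suc (r A)
  r⁺-¬spans A-¬spans = m≤n⇒m⊓n≡m (≰⇒> A-¬spans)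

  r≤r⁺ : ∀ A → r A ≤ r⁺ A
  r≤r⁺ A = ⊓-glb (n≤1+n (r A)) (r-mono (p⊆p∪q X))

  r⁺-self : r⁺ X ≡ r X
  r⁺-self = r⁺-spans (≤-reflexive (cong r (∪-idem X)))

  r⁺-⊆ : ∀ {A} → A ⊆ X → r⁺ A ≡ suc (r A) ⊓ r X
  r⁺-⊆ {A} A⊆X = cong (λ B → suc (r A) ⊓ r B) (p⊆q⇒p∪q≡q A⊆X)

  r⁺-monotone : ∀ {A B} → A ⊆ B → r⁺ A ≤ r⁺ B
  r⁺-monotone A⊆B = ⊓-mono-≤ (s≤s (r-mono A⊆B)) (r-mono (∪-mono-⊆ A⊆B ⊆-refl))

  r⁺-r-submodular : ∀ A B → r⁺ (A ∪ B) + r (A ∩ B) ≤ r A + r⁺ B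
  r⁺-r-submodular A B with spans? B
  ... | yes B-spans = subst₂ _≤_
    (cong (_+ r (A ∩ B)) (sym (r⁺-spans (spans-⊆ (q⊆p∪q A B) B-spans))))
    (cong (r A +_) (sym (r⁺-spans B-spans)))
    (submodular A B)
  ... | no B-¬spans = begin
    r⁺ (A ∪ B) + r (A ∩ B)      ≤⟨ +-monoˡ-≤ (r (A ∩ B)) (m⊓n≤m _ _) ⟩
    suc (r (A ∪ B) + r (A ∩ B)) ≤⟨ s≤s (submodular A B) ⟩
    suc (r A + r B)             ≡⟨ +-suc (r A) (r B) ⟨
    r A + suc (r B)             ≡⟨ cong (r A +_) (r⁺-¬spans B-¬spans) ⟨
    r A + r⁺ B                  ∎
    where open ≤-Reasoning

  r⁺-submodular-¬spans : ∀ {A} B → ¬ Spans A → r⁺ (A ∪ B) + r⁺ (A ∩ B) ≤ r⁺ A + r⁺ B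
  r⁺-submodular-¬spans {A} B A-¬spans = begin
    r⁺ (A ∪ B) + r⁺ (A ∩ B)      ≤⟨ +-monoʳ-≤ (r⁺ (A ∪ B)) (m⊓n≤m _ _) ⟩
    r⁺ (A ∪ B) + suc (r (A ∩ B)) ≡⟨ +-suc (r⁺ (A ∪ B)) (r (A ∩ B)) ⟩
    suc (r⁺ (A ∪ B) + r (A ∩ B)) ≤⟨ s≤s (r⁺-r-submodular A B) ⟩
    suc (r A + r⁺ B)             ≡⟨ cong (_+ r⁺ B) (r⁺-¬spans A-¬spans) ⟨
    r⁺ A + r⁺ B                  ∎
    where open ≤-Reasoning

  r⁺-submodular : ∀ A B → r⁺ (A ∪ B) + r⁺ (A ∩ B) ≤ r⁺ A + r⁺ B
  r⁺-submodular A B with spans? A | spans? B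
  ... | no A-¬spans | _ = r⁺-submodular-¬spans B A-¬spans
  ... | yes _ | no B-¬spans = subst₂ _≤_
    (cong₂ _+_ (cong r⁺ (∪-comm B A)) (cong r⁺ (∩-comm B A)))
    (+-comm (r⁺ B) (r⁺ A))
    (r⁺-submodular-¬spans A B-¬spans)
  ... | yes A-spans | yes B-spans = begin
    r⁺ (A ∪ B) + r⁺ (A ∩ B)     ≤⟨ +-mono-≤ (≤-reflexive (r⁺-spans (spans-⊆ (p⊆p∪q B) A-spans)))
                                            (m⊓n≤n _ _) ⟩
    r (A ∪ B) + r ((A ∩ B) ∪ X) ≤⟨ spans-modular A-spans B-spans ⟩
    r A + r B                   ≡⟨ cong₂ _+_ (r⁺-spans A-spans) (r⁺-spans B-spans) ⟨
    r⁺ A + r⁺ B                 ∎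
    where open ≤-Reasoning

  extendedRank : Subset n → Bool → ℕ
  extendedRank A false = r A
  extendedRank A true  = r⁺ A

  extendedRank-monotone : ∀ A a B b → extendedRank A a ≤ extendedRank (A ∪ B) (a ∨ b)
  extendedRank-monotone A false B false = r-mono (p⊆p∪q B)
  extendedRank-monotone A false B true  = ≤-trans (r-mono (p⊆p∪q B)) (r≤r⁺ (A ∪ B))
  extendedRank-monotone A true  B _     = r⁺-monotone (p⊆p∪q B)

  extendedRank-submodular : ∀ A a B b →
    extendedRank (A ∪ B) (a ∨ b) + extendedRank (A ∩ B) (a ∧ b) ≤ extendedRank A a + extendedRank B b
  extendedRank-submodular A false B false = submodular A B
  extendedRank-submodular A false B true  = r⁺-r-submodular A B
  extendedRank-submodular A true  B false = subst₂ _≤_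
    (cong₂ _+_ (cong r⁺ (∪-comm B A)) (cong r (∩-comm B A)))
    (+-comm (r B) (r⁺ A))
    (r⁺-r-submodular B A)
  extendedRank-submodular A true  B true  = r⁺-submodular A B

module NonmodularRankTwo {n : ℕ} {r : Subset n → ℕ} (isMatroid : IsMatroid n r) {X Y : Subset n}
         (Y-flat : IsFlat r Y) (nonmodular : Nonmodular r X Y) (rX≡2 : r X ≡ 2) where
  open Matroid isMatroid
  open PrincipalExtension isMatroid X
  open ≡-Reasoning

  rX∩Y≡0 : r (X ∩ Y) ≡ 0
  rX∩Y≡0 = proj₁ (nonmodular-rank≤2 Y-flat nonmodular (≤-reflexive rX≡2))

  rX∪Y≡1+rY : r (X ∪ Y) ≡ suc (r Y)
  rX∪Y≡1+rY = proj₂ (nonmodular-rank≤2 Y-flat nonmodular (≤-reflexive rX≡2))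

  r⁺-null : ∀ {A} → A ⊆ X → r A ≡ 0 → r⁺ A ≡ 1
  r⁺-null A⊆X rA≡0 = trans (r⁺-⊆ A⊆X) (cong₂ (λ a b → suc a ⊓ b) rA≡0 rX≡2)

  r⁺-nonnull : ∀ {A} → A ⊆ X → r A ≢ 0 → r⁺ A ≡ 2
  r⁺-nonnull {A} A⊆X rA≢0 =
    trans (r⁺-⊆ A⊆X) (trans (cong (suc (r A) ⊓_) rX≡2) (m≥n⇒m⊓n≡n (s≤s (n≢0⇒n>0 rA≢0))))

  r⁺⊥≡1 : r⁺ ⊥ ≡ 1
  r⁺⊥≡1 = r⁺-null ⊥⊆ r⊥≡0

  -- g(A | z) = r(A | Y), with both subtractions moved across.
  cond-z≡cond-Y : ∀ {A} → A ⊆ X → r⁺ A + r Y ≡ r (A ∪ Y) + r⁺ ⊥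
  cond-z≡cond-Y {A} A⊆X with r A ≟ 0
  ... | yes rA≡0 = begin
    r⁺ A + r Y       ≡⟨ cong (_+ r Y) (r⁺-null A⊆X rA≡0) ⟩
    1 + r Y          ≡⟨ +-comm 1 (r Y) ⟩
    r Y + 1          ≡⟨ cong₂ _+_ (rank-∪-null Y rA≡0) r⁺⊥≡1 ⟨
    r (A ∪ Y) + r⁺ ⊥ ∎
  ... | no rA≢0 = begin
    r⁺ A + r Y       ≡⟨ cong (_+ r Y) (r⁺-nonnull A⊆X rA≢0) ⟩
    2 + r Y          ≡⟨ +-comm 2 (r Y) ⟩
    r Y + 2          ≡⟨ +-suc (r Y) 1 ⟩
    suc (r Y) + 1    ≡⟨ cong₂ _+_ rA∪Y≡1+rY r⁺⊥≡1 ⟨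
    r (A ∪ Y) + r⁺ ⊥ ∎
    where rA∪Y≡1+rY = rank-∪-nonnull Y-flat rX∩Y≡0 rX∪Y≡1+rY A⊆X rA≢0

lemma5p4 : (n : ℕ) (r : Subset n → ℕ) → IsMatroid n r →
    (X Y : Subset n) → IsFlat r X → IsFlat r Y → Nonmodular r X Y →
    r X ≡ 2 → AdmitsAKExtension n r X Y
lemma5p4 n r isMatroid X Y _ Y-flat nonmodular rX≡2 =
  1 , toℚ ∘ extend , (isPolymatroid , extends) , AK1 , AK2
  where
  open Matroid isMatroid using (r⊥≡0)
  open PrincipalExtension isMatroid X
  open NonmodularRankTwo isMatroid Y-flat nonmodular rX≡2
  open OneElementExtension extendedRank
  open ≡-Reasoning

  isPolymatroid : IsPolymatroid (n + 1) (toℚ ∘ extend)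
  isPolymatroid = isPolymatroid-toℚ extend
    (trans (cong extend (⊥-++ n)) (trans (extend-++ ⊥ false) r⊥≡0))
    (extend-monotone extendedRank-monotone)
    (extend-submodular extendedRank-submodular)

  extends : ∀ S → toℚ (extend (embQ 1 S)) ≡ toℚ (r S)
  extends S = cong toℚ (extend-++ S false)

  AK1 : cond (toℚ ∘ extend) (Zset n 1) (embQ 1 X) ≡ 0ℚ
  AK1 = cond-toℚ-≡0 extend (begin
    extend (Zset n 1 ∪ embQ 1 X) ≡⟨ extend-zipWith _∨_ ⊥ true X false ⟩
    r⁺ (⊥ ∪ X)                   ≡⟨ cong r⁺ (∪-identityˡ X) ⟩
    r⁺ X                         ≡⟨ r⁺-self ⟩
    r X                          ≡⟨ extend-++ X false ⟨
    extend (embQ 1 X)            ∎)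

  AK2 : ∀ A → A ⊆ X →
        cond (toℚ ∘ extend) (embQ 1 A) (Zset n 1) ≡ cond (toℚ ∘ extend) (embQ 1 A) (embQ 1 Y)
  AK2 A A⊆X = cond-toℚ-≡ extend (begin
    extend (embQ 1 A ∪ Zset n 1) + extend (embQ 1 Y)
      ≡⟨ cong₂ _+_ (extend-zipWith _∨_ A false ⊥ true) (extend-++ Y false) ⟩
    r⁺ (A ∪ ⊥) + r Y
      ≡⟨ cong (λ B → r⁺ B + r Y) (∪-identityʳ A) ⟩
    r⁺ A + r Y
      ≡⟨ cond-z≡cond-Y A⊆X ⟩
    r (A ∪ Y) + r⁺ ⊥
      ≡⟨ cong₂ _+_ (extend-zipWith _∨_ A false Y false) (extend-++ ⊥ true) ⟨
    extend (embQ 1 A ∪ embQ 1 Y) + extend (Zset n 1) ∎)
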